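{- Let $C\subseteq[n]$, viewed as a single column of boxes in the rows $i\in C$, and let $r_C$ be the rank function of the Schubert matroid $SM_n(C)$. For any subset $S\subseteq[n]$, \[r_C(S)=\max\{|\mathcal{F}|\colon \mathcal{F}\in\mathcal{F}(C,S)\}.\]
   Context: For $S\subseteq[n]$, the Schubert matroid $SM_n(S)$ on $[n]$ has bases the sets $T\subseteq[n]$ with $\#T=\#S$ such that, writing $T=\{a_1<\dots<a_k\}$, $S=\{b_1<\dots<b_k\}$, $a_i\le b_i$ for all $i$; its rank function is $r(U)=\max\{\#(U\cap B): B \text{ a basis}\}$. A filling of $C$ is an assignment of positive integers to some of the boxes of $C$ (the others are empty); $|\mathcal{F}|$ is the number of nonempty boxes. A filling is column-strict if the assigned integers are distinct, and flagged if every integer placed in the box of row $i$ is $\le i$. $\mathcal{F}(C,S)$ is the set of column-strict flagged fillings of $C$ all of whose entries belong to $S$. -}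

module Defs where

open import Data.Nat using (ℕ; zero; suc; _⊔_)
open import Data.Fin using (Fin; zero; suc) renaming (_≤_ to _≤ᶠ_; _≤?_ to _≤ᶠ?_)
open import Data.Fin.Subset using (Subset; inside; outside; _∈_; _∩_; ∣_∣)
open import Data.Vec using (Vec; []; _∷_; tabulate)
open import Data.List using (List; []; _∷_; map; filter; foldr; _++_)
open import Data.List.Relation.Binary.Pointwise using (Pointwise)
import Data.List.Relation.Binary.Pointwise as PW
open import Data.Maybe using (Maybe; just; nothing; is-just)
open import Data.Product using (_×_)
open import Relation.Binary.PropositionalEquality using (_≡_)
open import Relation.Nullary using (Dec)

-- Convention: the ground set [n] = {1,…,n} is represented by Fin n,
-- the element i : Fin n standing for the integer toℕ i + 1.
-- Subsets of [n] are Data.Fin.Subset.Subset n.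

elems : ∀ {n} → Subset n → List (Fin n)
elems []             = []
elems (inside  ∷ p) = zero ∷ map suc (elems p)
elems (outside ∷ p) = map suc (elems p)

allSubsets : ∀ n → List (Subset n)
allSubsets zero    = [] ∷ []
allSubsets (suc n) = map (inside ∷_) (allSubsets n) ++ map (outside ∷_) (allSubsets n)

-- T is a basis of the Schubert matroid SM_n(S):
-- #T = #S and, writing T = {a₁<…<a_k}, S = {b₁<…<b_k}, aᵢ ≤ bᵢ for all i.
-- (Pointwise forces the two increasing lists to have equal length.)
IsSchubertBasis : ∀ {n} → Subset n → Subset n → Set
IsSchubertBasis S T = Pointwise _≤ᶠ_ (elems T) (elems S)

isSchubertBasis? : ∀ {n} (S T : Subset n) → Dec (IsSchubertBasis S T)
isSchubertBasis? S T = PW.decidable _≤ᶠ?_ (elems T) (elems S)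

schubertBases : ∀ {n} → Subset n → List (Subset n)
schubertBases {n} S = filter (isSchubertBasis? S) (allSubsets n)

maximum : List ℕ → ℕ
maximum = foldr _⊔_ 0

schubertRank : ∀ {n} → Subset n → Subset n → ℕ
schubertRank S U = maximum (map (λ B → ∣ U ∩ B ∣) (schubertBases S))

-- A filling of the single column C ⊆ [n] (boxes in rows i ∈ C):
-- row i holds either nothing or a positive integer (an element of Fin n,
-- by the same shift convention). Boxes exist only in rows of C, which is
-- imposed by the condition OnlyInColumn below.
Filling : ℕ → Set
Filling n = Fin n → Maybe (Fin n)

OnlyInColumn : ∀ {n} → Subset n → Filling n → Set
OnlyInColumn C F = ∀ i j → F i ≡ just j → i ∈ C

ColumnStrict : ∀ {n} → Filling n → Set
ColumnStrict F = ∀ i i' j → F i ≡ just j → F i' ≡ just j → i ≡ i'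

Flagged : ∀ {n} → Filling n → Set
Flagged F = ∀ i j → F i ≡ just j → j ≤ᶠ i

EntriesIn : ∀ {n} → Subset n → Filling n → Set
EntriesIn S F = ∀ i j → F i ≡ just j → j ∈ S

InFillings : ∀ {n} → Subset n → Subset n → Filling n → Set
InFillings C S F = OnlyInColumn C F × ColumnStrict F × Flagged F × EntriesIn S F

fillingSize : ∀ {n} → Filling n → ℕ
fillingSize F = ∣ tabulate (λ i → is-just (F i)) ∣

{-# OPTIONS --safe #-}
-- Scan the rows 0, 1, …, n − 1, offering each element of S when its row is reached and
-- placing a pending offered element in every row of C where one is available; let g be
-- the number of rows filled.  For every threshold t, a filling has at most
-- #(S ∩ [0,t)) + #(C ∩ [t,n)) entries, and so does S ∩ B for every basis B, because the
-- bases of SM(C) are the sets with as many elements as C that dominate C in every prefix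
-- count; the greedy scan attains this bound for some t.  Conversely the greedy filling
-- has g entries, and its entries together with its unfilled rows of C form a basis B
-- with g ≤ #(S ∩ B).
module Submission where

open import Defs
open import Data.Bool using (Bool; true; false; _∧_; _∨_; not)
open import Data.Bool.Properties using (∧-conicalˡ; ∧-conicalʳ)
open import Data.Empty using (⊥-elim)
open import Data.Fin using (Fin; zero; suc; toℕ; fromℕ<)
open import Data.Fin.Properties using (toℕ-fromℕ<; toℕ-injective)
open import Data.Fin.Subset using (Subset; inside; outside; _∈_; _∩_; ∣_∣)
open import Data.List using (List; []; _∷_; map)
open import Data.List.Membership.Propositional using () renaming (_∈_ to _∈ₗ_)
open import Data.List.Membership.Propositional.Properties using (∈-map⁺; ∈-++⁺ˡ; ∈-++⁺ʳ; ∈-filter⁺; ∈-filter⁻)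
open import Data.List.Properties using (map-∘)
open import Data.List.Relation.Binary.Pointwise using (Pointwise; []; _∷_)
import Data.List.Relation.Binary.Pointwise as PW
open import Data.List.Relation.Unary.Any using (here; there)
open import Data.Maybe using (Maybe; just; nothing; is-just)
import Data.Maybe as Maybe
open import Data.Nat using (ℕ; zero; suc; pred; _+_; _≤_; _<_; _≤′_; ≤′-refl; ≤′-step; _<ᵇ_; z≤n; s≤s; s≤s⁻¹; _≟_; _≤?_; _<?_)
open import Data.Nat.Properties
open import Data.Product using (Σ; ∃-syntax; _×_; _,_; proj₂; map₁; map₂)
open import Data.Sum using (_⊎_; inj₁; inj₂)
open import Data.Vec using ([]; _∷_; here; there; tabulate)
open import Function using (_⇔_; mk⇔; Equivalence; _∘_)
open import Function.Construct.Composition using (_⇔-∘_)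
open import Function.Construct.Symmetry using (⇔-sym)
open import Relation.Nullary using (yes; no; ¬_)
open import Relation.Binary.PropositionalEquality
import Algebra.Properties.CommutativeSemigroup +-commutativeSemigroup as +-CS

-- Counting on prefixes of ℕ

boolToℕ : Bool → ℕ
boolToℕ false = 0
boolToℕ true  = 1

count : (ℕ → Bool) → ℕ → ℕ
count p zero    = 0
count p (suc k) = count p k + boolToℕ (p k)

infix 4 _⊆ᵇ_
_⊆ᵇ_ : (ℕ → Bool) → (ℕ → Bool) → Set
p ⊆ᵇ q = ∀ r → p r ≡ true → q r ≡ true

_[_≔_] : {A : Set} → (ℕ → A) → ℕ → A → ℕ → A
(f [ j ≔ a ]) x with x ≟ j
... | yes _ = a
... | no  _ = f x

update-≡ : ∀ {A : Set} (f : ℕ → A) j a → (f [ j ≔ a ]) j ≡ a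
update-≡ f j a with j ≟ j
... | yes _   = refl
... | no  j≢j = ⊥-elim (j≢j refl)

update-≢ : ∀ {A : Set} (f : ℕ → A) {j x} a → x ≢ j → (f [ j ≔ a ]) x ≡ f x
update-≢ f {j} {x} a x≢j with x ≟ j
... | yes x≡j = ⊥-elim (x≢j x≡j)
... | no  _   = refl

boolToℕ-mono : ∀ {a b} → (a ≡ true → b ≡ true) → boolToℕ a ≤ boolToℕ b
boolToℕ-mono {false} _   = z≤n
boolToℕ-mono {true}  a⇒b rewrite a⇒b refl = ≤-refl

count-cong : ∀ {p q} m → (∀ r → r < m → p r ≡ q r) → count p m ≡ count q m
count-cong zero    _   = refl
count-cong (suc m) p≗q =
  cong₂ _+_ (count-cong m (λ r r<m → p≗q r (m<n⇒m<1+n r<m))) (cong boolToℕ (p≗q m ≤-refl))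

count-mono : ∀ {p q} → p ⊆ᵇ q → ∀ m → count p m ≤ count q m
count-mono p⊆q zero    = z≤n
count-mono p⊆q (suc m) = +-mono-≤ (count-mono p⊆q m) (boolToℕ-mono (p⊆q m))

count-shift : ∀ p k → count p (suc k) ≡ boolToℕ (p 0) + count (λ r → p (suc r)) k
count-shift p zero    = +-comm 0 (boolToℕ (p 0))
count-shift p (suc k) =
  trans (cong (_+ boolToℕ (p (suc k))) (count-shift p k)) (+-assoc (boolToℕ (p 0)) _ _)

count-+ : ∀ {p q s} m → (∀ r → boolToℕ (p r) + boolToℕ (q r) ≡ boolToℕ (s r)) →
          count p m + count q m ≡ count s m
count-+ zero    _  = refl
count-+ {p} {q} (suc m) pq≡s =
  trans (+-CS.interchange (count p m) _ (count q m) _) (cong₂ _+_ (count-+ m pq≡s) (pq≡s m))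

count-update : ∀ p j b m → j < m → count (p [ j ≔ b ]) m + boolToℕ (p j) ≡ count p m + boolToℕ b
count-update p j b (suc m) j<1+m with m≤n⇒m<n∨m≡n (s≤s⁻¹ j<1+m)
... | inj₁ j<m = begin
  (count (p [ j ≔ b ]) m + boolToℕ ((p [ j ≔ b ]) m)) + boolToℕ (p j)
    ≡⟨ cong (λ x → (count (p [ j ≔ b ]) m + boolToℕ x) + boolToℕ (p j)) (update-≢ p b (>⇒≢ j<m)) ⟩
  (count (p [ j ≔ b ]) m + boolToℕ (p m)) + boolToℕ (p j)
    ≡⟨ +-CS.xy∙z≈xz∙y (count (p [ j ≔ b ]) m) _ _ ⟩
  (count (p [ j ≔ b ]) m + boolToℕ (p j)) + boolToℕ (p m)
    ≡⟨ cong (_+ boolToℕ (p m)) (count-update p j b m j<m) ⟩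
  (count p m + boolToℕ b) + boolToℕ (p m)
    ≡⟨ +-CS.xy∙z≈xz∙y (count p m) _ _ ⟩
  (count p m + boolToℕ (p m)) + boolToℕ b ∎
  where open ≡-Reasoning
... | inj₂ refl = begin
  (count (p [ m ≔ b ]) m + boolToℕ ((p [ m ≔ b ]) m)) + boolToℕ (p m)
    ≡⟨ cong₂ (λ x y → (x + boolToℕ y) + boolToℕ (p m))
             (count-cong m (λ r r<m → update-≢ p b (<⇒≢ r<m))) (update-≡ p m b) ⟩
  (count p m + boolToℕ b) + boolToℕ (p m)
    ≡⟨ +-CS.xy∙z≈xz∙y (count p m) _ _ ⟩
  (count p m + boolToℕ (p m)) + boolToℕ b ∎
  where open ≡-Reasoning

count-<⇒witness : ∀ p q m → count p m < count q m → ∃[ j ] j < m × q j ≡ true × p j ≡ false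
count-<⇒witness p q (suc m) lt with q m in qm | p m in pm
... | true  | false = m , ≤-refl , qm , pm
... | true  | true  =
  map₂ (map₁ m<n⇒m<1+n) (count-<⇒witness p q m (+-cancelʳ-< _ _ _ lt))
... | false | _     =
  map₂ (map₁ m<n⇒m<1+n) (count-<⇒witness p q m (+-cancelʳ-< _ _ _ (<-≤-trans lt (+-monoʳ-≤ _ z≤n))))

count-increments : ∀ {p q} → p ⊆ᵇ q → ∀ {t k} → t ≤′ k → count p k + count q t ≤ count p t + count q k
count-increments p⊆q ≤′-refl = ≤-refl
count-increments {p} {q} p⊆q {t} (≤′-step {k} t≤k) = begin
  (count p k + boolToℕ (p k)) + count q t ≡⟨ +-CS.xy∙z≈xz∙y (count p k) _ _ ⟩
  (count p k + count q t) + boolToℕ (p k) ≤⟨ +-mono-≤ (count-increments p⊆q t≤k) (boolToℕ-mono (p⊆q k)) ⟩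
  (count p t + count q k) + boolToℕ (q k) ≡⟨ +-assoc (count p t) _ _ ⟩
  count p t + (count q k + boolToℕ (q k)) ∎
  where open ≤-Reasoning

+-both-≤ : ∀ {a b c d x y} → x ≡ y → a + b ≤ c + d → a + (b + x) ≤ (c + y) + d
+-both-≤ {a} {b} {c} {d} {x} refl ab≤cd = begin
  a + (b + x) ≡⟨ +-assoc a b x ⟨
  (a + b) + x ≤⟨ +-monoˡ-≤ x ab≤cd ⟩
  (c + d) + x ≡⟨ +-CS.xy∙z≈xz∙y c d x ⟩
  (c + x) + d ∎
  where open ≤-Reasoning

filled : {A : Set} → (ℕ → Maybe A) → ℕ → Bool
filled f r = is-just (f r)

ColumnStrictℕ : (ℕ → Maybe ℕ) → Set
ColumnStrictℕ f = ∀ r r′ j → f r ≡ just j → f r′ ≡ just j → r ≡ r′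

Flaggedℕ : (ℕ → Maybe ℕ) → Set
Flaggedℕ f = ∀ r j → f r ≡ just j → j ≤ r

-- The entry of row k lies in [0, k] by flagging and in no earlier row by strictness,
-- so it can be deleted from P before recursing on the rows below k.
count-filled≤count-entries : ∀ {f} → ColumnStrictℕ f → Flaggedℕ f → ∀ k P →
  (∀ r j → r < k → f r ≡ just j → P j ≡ true) → count (filled f) k ≤ count P k
count-filled≤count-entries                   injective flagged zero    P entries = z≤n
count-filled≤count-entries {f} injective flagged (suc k) P entries with f k in fk
... | nothing = begin
  count (filled f) k + 0 ≡⟨ +-identityʳ _ ⟩
  count (filled f) k     ≤⟨ count-filled≤count-entries injective flagged k P (λ r j r<k → entries r j (m<n⇒m<1+n r<k)) ⟩
  count P k              ≤⟨ m≤m+n _ _ ⟩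
  count P (suc k)        ∎
  where open ≤-Reasoning
... | just j = begin
  count (filled f) k + 1               ≤⟨ +-monoˡ-≤ 1 (count-filled≤count-entries injective flagged k P′ entries′) ⟩
  count P′ k + 1                       ≤⟨ +-monoˡ-≤ 1 (m≤m+n _ _) ⟩
  count P′ (suc k) + 1                 ≡⟨ cong (λ b → count P′ (suc k) + boolToℕ b) (sym Pj) ⟩
  count P′ (suc k) + boolToℕ (P j)     ≡⟨ count-update P j false (suc k) (s≤s (flagged k j fk)) ⟩
  count P (suc k) + 0                  ≡⟨ +-identityʳ _ ⟩
  count P (suc k)                      ∎
  where
  open ≤-Reasoning
  P′ : ℕ → Bool
  P′ = P [ j ≔ false ]
  Pj : P j ≡ true
  Pj = entries k j ≤-refl fk
  entries′ : ∀ r x → r < k → f r ≡ just x → P′ x ≡ true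
  entries′ r x r<k fr with x ≟ j
  ... | yes refl = ⊥-elim (<⇒≢ r<k (injective r k x fr fk))
  ... | no  _    = entries r x (m<n⇒m<1+n r<k) fr

filling-hall-bound : ∀ {C S f} → filled f ⊆ᵇ C → ColumnStrictℕ f → Flaggedℕ f →
  (∀ r j → f r ≡ just j → S j ≡ true) →
  ∀ {t k} → t ≤ k → count (filled f) k + count C t ≤ count S t + count C k
filling-hall-bound {C} {S} {f} rows injective flagged entries {t} {k} t≤k = begin
  count (filled f) k + count C t ≤⟨ count-increments rows (≤⇒≤′ t≤k) ⟩
  count (filled f) t + count C k ≤⟨ +-monoˡ-≤ _ (count-filled≤count-entries injective flagged t S (λ r j _ → entries r j)) ⟩
  count S t + count C k          ∎
  where open ≤-Reasoning

basis-hall-bound : ∀ {C S B n} → (∀ k → count C k ≤ count B k) → count C n ≡ count B n →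
  ∀ {t} → t ≤ n → count (λ x → S x ∧ B x) n + count C t ≤ count S t + count C n
basis-hall-bound {C} {S} {B} {n} dominates total {t} t≤n = begin
  count S∩B n + count C t ≤⟨ +-monoʳ-≤ _ (dominates t) ⟩
  count S∩B n + count B t ≤⟨ count-increments (λ r → ∧-conicalʳ (S r) (B r)) (≤⇒≤′ t≤n) ⟩
  count S∩B t + count B n ≡⟨ cong (count S∩B t +_) (sym total) ⟩
  count S∩B t + count C n ≤⟨ +-monoˡ-≤ _ (count-mono (λ r → ∧-conicalˡ (S r) (B r)) t) ⟩
  count S t + count C n   ∎
  where
  open ≤-Reasoning
  S∩B : ℕ → Bool
  S∩B x = S x ∧ B x

-- The greedy scan

module Greedy (C S : ℕ → Bool) where

  settle : Bool → ℕ → ℕ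
  settle true  = pred
  settle false = λ a → a

  -- pending k: elements of S below k offered but not yet placed.
  pending : ℕ → ℕ
  pending zero    = 0
  pending (suc k) = settle (C k) (pending k + boolToℕ (S k))

  offered : ℕ → ℕ
  offered k = pending k + boolToℕ (S k)

  fills : ℕ → Bool
  fills k = C k ∧ (0 <ᵇ offered k)

  greedy : ℕ → ℕ
  greedy = count fills

  fills+settle : ∀ c a → boolToℕ (c ∧ (0 <ᵇ a)) + settle c a ≡ a
  fills+settle true  zero    = refl
  fills+settle true  (suc a) = refl
  fills+settle false a       = refl

  greedy+pending : ∀ k → greedy k + pending k ≡ count S k
  greedy+pending zero    = refl
  greedy+pending (suc k) = begin
    (greedy k + boolToℕ (fills k)) + settle (C k) (offered k) ≡⟨ +-assoc (greedy k) _ _ ⟩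
    greedy k + (boolToℕ (fills k) + settle (C k) (offered k)) ≡⟨ cong (greedy k +_) (fills+settle (C k) (offered k)) ⟩
    greedy k + (pending k + boolToℕ (S k))                    ≡⟨ +-assoc (greedy k) _ _ ⟨
    (greedy k + pending k) + boolToℕ (S k)                    ≡⟨ cong (_+ boolToℕ (S k)) (greedy+pending k) ⟩
    count S k + boolToℕ (S k)                                 ∎
    where open ≡-Reasoning

  count-S-suc : ∀ k → count S (suc k) ≡ greedy k + offered k
  count-S-suc k = begin
    count S k + boolToℕ (S k)              ≡⟨ cong (_+ boolToℕ (S k)) (greedy+pending k) ⟨
    (greedy k + pending k) + boolToℕ (S k) ≡⟨ +-assoc (greedy k) _ _ ⟩
    greedy k + offered k                   ∎
    where open ≡-Reasoning

  fills⇒C : fills ⊆ᵇ C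
  fills⇒C r fr with C r
  ... | true = refl

  fills⇒offered : ∀ r → fills r ≡ true → 0 < offered r
  fills⇒offered r fr with C r | offered r
  ... | true | suc a = s≤s z≤n

  unfilled⇒¬S : ∀ r → C r ≡ true → fills r ≡ false → S r ≡ false
  unfilled⇒¬S r Cr ¬fr rewrite Cr with offered r in eq
  ... | zero with S r | m+n≡0⇒n≡0 (pending r) eq
  ...   | false | _ = refl

  filled-or-saturated : ∀ k → boolToℕ (C k) ≡ boolToℕ (fills k) ⊎ count S (suc k) ≡ greedy (suc k)
  filled-or-saturated k with C k | offered k | greedy+pending (suc k)
  ... | false | _     | _     = inj₁ refl
  ... | true  | suc _ | _     = inj₁ refl
  ... | true  | zero  | exact = inj₂ (trans (sym exact) (+-identityʳ _))

  -- [0, t) is the last prefix all of whose elements of S have been placed.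
  greedy-hall : ∀ k → ∃[ t ] t ≤ k × count S t + count C k ≤ greedy k + count C t
  greedy-hall zero = 0 , z≤n , z≤n
  greedy-hall (suc k) with greedy-hall k | filled-or-saturated k
  ... | t , t≤k , bound | inj₁ same      = t , m≤n⇒m≤1+n t≤k , +-both-≤ {count S t} {count C k} {greedy k} same bound
  ... | _               | inj₂ saturated = suc k , ≤-refl , +-monoˡ-≤ _ (≤-reflexive saturated)

  hall-bound⇒≤greedy : ∀ {v n} → (∀ {t} → t ≤ n → v + count C t ≤ count S t + count C n) → v ≤ greedy n
  hall-bound⇒≤greedy {v} {n} bound with greedy-hall n
  ... | t , t≤n , attained = +-cancelʳ-≤ (count C t) v (greedy n) (≤-trans (bound t≤n) attained)

  -- The greedy filling of the rows below k; `used` is the set of its entries.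
  record GreedyFilling (k : ℕ) : Set where
    field
      entry        : ℕ → Maybe ℕ
      used         : ℕ → Bool
      filled≡fills : ∀ r → r < k → filled entry r ≡ fills r
      empty-above  : ∀ r → k ≤ r → entry r ≡ nothing
      injective    : ColumnStrictℕ entry
      flagged      : Flaggedℕ entry
      entry-used   : ∀ r j → entry r ≡ just j → used j ≡ true
      used⇒S       : used ⊆ᵇ S
      used-below   : ∀ j → used j ≡ true → j < k
      count-used   : count used k ≡ greedy k

  module _ {k} (G : GreedyFilling k) where
    open GreedyFilling G

    unused-at : used k ≡ false
    unused-at with used k in uk
    ... | false = refl
    ... | true  = ⊥-elim (<-irrefl refl (used-below k uk))

    count-used-suc : count used (suc k) ≡ greedy k
    count-used-suc = begin
      count used k + boolToℕ (used k) ≡⟨ cong (λ b → count used k + boolToℕ b) unused-at ⟩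
      count used k + 0                ≡⟨ +-identityʳ _ ⟩
      count used k                    ≡⟨ count-used ⟩
      greedy k                        ∎
      where open ≡-Reasoning

    free-entry : fills k ≡ true → ∃[ j ] j < suc k × S j ≡ true × used j ≡ false
    free-entry fk = count-<⇒witness used S (suc k) (begin-strict
      count used (suc k)   ≡⟨ count-used-suc ⟩
      greedy k             <⟨ m<m+n (greedy k) (fills⇒offered k fk) ⟩
      greedy k + offered k ≡⟨ count-S-suc k ⟨
      count S (suc k)      ∎)
      where open ≤-Reasoning

    filled-below : ∀ r → filled entry r ≡ true → r < k
    filled-below r fr with k ≤? r
    ... | no  k≰r = ≰⇒> k≰r
    ... | yes k≤r with trans (sym fr) (cong is-just (empty-above r k≤r))
    ...   | ()

    filled⇒C : filled entry ⊆ᵇ C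
    filled⇒C r fr = fills⇒C r (trans (sym (filled≡fills r (filled-below r fr))) fr)

    count-filled : count (filled entry) k ≡ greedy k
    count-filled = count-cong k filled≡fills

    skip : fills k ≡ false → GreedyFilling (suc k)
    skip fk = record
      { entry        = entry
      ; used         = used
      ; filled≡fills = filled≡fills′
      ; empty-above  = λ r 1+k≤r → empty-above r (<⇒≤ 1+k≤r)
      ; injective    = injective
      ; flagged      = flagged
      ; entry-used   = entry-used
      ; used⇒S       = used⇒S
      ; used-below   = λ j uj → m<n⇒m<1+n (used-below j uj)
      ; count-used   = trans count-used-suc (trans (sym (+-identityʳ _)) (cong (λ b → greedy k + boolToℕ b) (sym fk)))
      }
      where
      filled≡fills′ : ∀ r → r < suc k → filled entry r ≡ fills r
      filled≡fills′ r r<1+k with r ≟ k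
      ... | yes refl = trans (cong is-just (empty-above k ≤-refl)) (sym fk)
      ... | no  r≢k  = filled≡fills r (≤∧≢⇒< (s≤s⁻¹ r<1+k) r≢k)

    place : fills k ≡ true → ∀ j → j < suc k → S j ≡ true → used j ≡ false → GreedyFilling (suc k)
    place fk j j<1+k Sj free = record
      { entry        = entry′
      ; used         = used′
      ; filled≡fills = filled≡fills′
      ; empty-above  = empty-above′
      ; injective    = injective′
      ; flagged      = flagged′
      ; entry-used   = entry-used′
      ; used⇒S       = used⇒S′
      ; used-below   = used-below′
      ; count-used   = count-used′
      }
      where
      entry′ : ℕ → Maybe ℕ
      entry′ = entry [ k ≔ just j ]
      used′ : ℕ → Bool
      used′ = used [ j ≔ true ]

      filled≡fills′ : ∀ r → r < suc k → filled entry′ r ≡ fills r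
      filled≡fills′ r r<1+k with r ≟ k
      ... | yes refl = sym fk
      ... | no  r≢k  = filled≡fills r (≤∧≢⇒< (s≤s⁻¹ r<1+k) r≢k)

      empty-above′ : ∀ r → suc k ≤ r → entry′ r ≡ nothing
      empty-above′ r 1+k≤r with r ≟ k
      ... | yes refl = ⊥-elim (<-irrefl refl 1+k≤r)
      ... | no  _    = empty-above r (<⇒≤ 1+k≤r)

      -- An entry placed earlier is used, while j is not.
      injective′ : ColumnStrictℕ entry′
      injective′ r r′ x e e′ with r ≟ k | r′ ≟ k
      ... | yes r≡k | yes r′≡k = trans r≡k (sym r′≡k)
      injective′ r r′ x refl e′ | yes _ | no _ with trans (sym (entry-used r′ j e′)) free
      ... | ()
      injective′ r r′ x e refl | no _ | yes _ with trans (sym (entry-used r j e)) free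
      ... | ()
      injective′ r r′ x e e′ | no _ | no _ = injective r r′ x e e′

      flagged′ : Flaggedℕ entry′
      flagged′ r x e with r ≟ k
      flagged′ r x refl | yes refl = s≤s⁻¹ j<1+k
      flagged′ r x e    | no  _    = flagged r x e

      used′-mono : ∀ x → used x ≡ true → used′ x ≡ true
      used′-mono x ux with x ≟ j
      ... | yes _ = refl
      ... | no  _ = ux

      entry-used′ : ∀ r x → entry′ r ≡ just x → used′ x ≡ true
      entry-used′ r x e with r ≟ k
      entry-used′ r x refl | yes refl = update-≡ used j true
      entry-used′ r x e    | no  _    = used′-mono x (entry-used r x e)

      used⇒S′ : used′ ⊆ᵇ S
      used⇒S′ x ux with x ≟ j
      ... | yes refl = Sj
      ... | no  _    = used⇒S x ux

      used-below′ : ∀ x → used′ x ≡ true → x < suc k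
      used-below′ x ux with x ≟ j
      ... | yes refl = j<1+k
      ... | no  _    = m<n⇒m<1+n (used-below x ux)

      count-used′ : count used′ (suc k) ≡ greedy (suc k)
      count-used′ = begin
        count used′ (suc k)                    ≡⟨ +-identityʳ _ ⟨
        count used′ (suc k) + 0                ≡⟨ cong (λ b → count used′ (suc k) + boolToℕ b) free ⟨
        count used′ (suc k) + boolToℕ (used j) ≡⟨ count-update used j true (suc k) j<1+k ⟩
        count used (suc k) + 1                 ≡⟨ cong (_+ 1) count-used-suc ⟩
        greedy k + 1                           ≡⟨ cong (λ b → greedy k + boolToℕ b) fk ⟨
        greedy (suc k)                         ∎
        where open ≡-Reasoning

  greedyFilling : ∀ k → GreedyFilling k
  greedyFilling zero = record
    { entry        = λ _ → nothing
    ; used         = λ _ → false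
    ; filled≡fills = λ _ ()
    ; empty-above  = λ _ _ → refl
    ; injective    = λ _ _ _ ()
    ; flagged      = λ _ _ ()
    ; entry-used   = λ _ _ ()
    ; used⇒S       = λ _ ()
    ; used-below   = λ _ ()
    ; count-used   = refl
    }
  greedyFilling (suc k) with fills k in fk
  ... | false = skip (greedyFilling k) fk
  ... | true with free-entry (greedyFilling k) fk
  ...   | j , j<1+k , Sj , free = place (greedyFilling k) fk j j<1+k Sj free

  module GreedyBasis (n : ℕ) (C-beyond : ∀ r → n ≤ r → C r ≡ false) where
    open GreedyFilling (greedyFilling n)

    unfilledC : ℕ → Bool
    unfilledC x = C x ∧ not (filled entry x)

    basis : ℕ → Bool
    basis x = used x ∨ unfilledC x

    -- An unfilled row of C had nothing offered, so it is not in S.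
    used⇒¬unfilledC : ∀ x → used x ≡ true → unfilledC x ≡ false
    used⇒¬unfilledC x ux with C x in Cx | filled entry x in fx
    ... | false | _     = refl
    ... | true  | true  = refl
    ... | true  | false with trans (sym (used⇒S x ux)) (unfilled⇒¬S x Cx
                               (trans (sym (filled≡fills x (used-below x ux))) fx))
    ...   | ()

    filled+unfilledC : ∀ m → count (filled entry) m + count unfilledC m ≡ count C m
    filled+unfilledC m = count-+ m split
      where
      split : ∀ r → boolToℕ (filled entry r) + boolToℕ (unfilledC r) ≡ boolToℕ (C r)
      split r with filled entry r in fr | C r in Cr
      ... | true  | true  = refl
      ... | false | true  = refl
      ... | false | false = refl
      ... | true  | false with trans (sym (filled⇒C (greedyFilling n) r fr)) Cr
      ...   | ()

    used+unfilledC : ∀ m → count used m + count unfilledC m ≡ count basis m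
    used+unfilledC m = count-+ m split
      where
      split : ∀ r → boolToℕ (used r) + boolToℕ (unfilledC r) ≡ boolToℕ (basis r)
      split r with used r in ur
      ... | true  = cong (λ b → 1 + boolToℕ b) (used⇒¬unfilledC r ur)
      ... | false = refl

    basis-dominates : ∀ m → count C m ≤ count basis m
    basis-dominates m = begin
      count C m                                     ≡⟨ filled+unfilledC m ⟨
      count (filled entry) m + count unfilledC m    ≤⟨ +-monoˡ-≤ _ (count-filled≤count-entries injective flagged m used (λ r j _ → entry-used r j)) ⟩
      count used m + count unfilledC m              ≡⟨ used+unfilledC m ⟩
      count basis m                                 ∎
      where open ≤-Reasoning

    basis-total : count C n ≡ count basis n
    basis-total = begin
      count C n                                  ≡⟨ filled+unfilledC n ⟨
      count (filled entry) n + count unfilledC n ≡⟨ cong (_+ count unfilledC n) (trans (count-filled (greedyFilling n)) (sym count-used)) ⟩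
      count used n + count unfilledC n           ≡⟨ used+unfilledC n ⟩
      count basis n                              ∎
      where open ≡-Reasoning

    greedy≤count-S∩basis : greedy n ≤ count (λ x → S x ∧ basis x) n
    greedy≤count-S∩basis = begin
      greedy n     ≡⟨ count-used ⟨
      count used n ≤⟨ count-mono used⊆S∩basis n ⟩
      count (λ x → S x ∧ basis x) n ∎
      where
      open ≤-Reasoning
      used⊆S∩basis : used ⊆ᵇ (λ x → S x ∧ basis x)
      used⊆S∩basis x ux rewrite used⇒S x ux | ux = refl

    basis-beyond : ∀ x → n ≤ x → basis x ≡ false
    basis-beyond x n≤x with used x in ux
    ... | true  = ⊥-elim (<⇒≱ (used-below x ux) n≤x)
    ... | false rewrite C-beyond x n≤x = refl

member : ∀ {n} → Subset n → ℕ → Bool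
member []      _       = false
member (b ∷ p) zero    = b
member (b ∷ p) (suc r) = member p r

count-member-∷ : ∀ {n} b (p : Subset n) k → count (member (b ∷ p)) (suc k) ≡ boolToℕ b + count (member p) k
count-member-∷ b p = count-shift (member (b ∷ p))

∣∣≡count-member : ∀ {n} (p : Subset n) → ∣ p ∣ ≡ count (member p) n
∣∣≡count-member []                    = refl
∣∣≡count-member {suc n} (inside  ∷ p) = trans (cong suc (∣∣≡count-member p)) (sym (count-member-∷ inside p n))
∣∣≡count-member {suc n} (outside ∷ p) = trans (∣∣≡count-member p) (sym (count-member-∷ outside p n))

member-∩ : ∀ {n} (p q : Subset n) r → member (p ∩ q) r ≡ member p r ∧ member q r
member-∩ []      []      r       = refl
member-∩ (b ∷ p) (c ∷ q) zero    = refl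
member-∩ (b ∷ p) (c ∷ q) (suc r) = member-∩ p q r

member-beyond : ∀ {n} (p : Subset n) r → n ≤ r → member p r ≡ false
member-beyond []      r       _        = refl
member-beyond (b ∷ p) (suc r) (s≤s n≤r) = member-beyond p r n≤r

∈⇒member : ∀ {n} {i : Fin n} {p} → i ∈ p → member p (toℕ i) ≡ true
∈⇒member here          = refl
∈⇒member (there i∈p)   = ∈⇒member i∈p

member⇒∈ : ∀ {n} (i : Fin n) p → member p (toℕ i) ≡ true → i ∈ p
member⇒∈ zero    (inside ∷ p) refl = here
member⇒∈ (suc i) (b ∷ p)      i∈p  = there (member⇒∈ i p i∈p)

subsetOf : ∀ n → (ℕ → Bool) → Subset n
subsetOf zero    P = []
subsetOf (suc n) P = P 0 ∷ subsetOf n (λ r → P (suc r))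

member-subsetOf : ∀ n P → (∀ r → n ≤ r → P r ≡ false) → ∀ r → member (subsetOf n P) r ≡ P r
member-subsetOf zero    P beyond r       = sym (beyond r z≤n)
member-subsetOf (suc n) P beyond zero    = refl
member-subsetOf (suc n) P beyond (suc r) =
  member-subsetOf n (λ r → P (suc r)) (λ r n≤r → beyond (suc r) (s≤s n≤r)) r

-- Schubert bases and prefix counts

elemsℕ : ∀ {n} → Subset n → List ℕ
elemsℕ []            = []
elemsℕ (inside  ∷ p) = 0 ∷ map suc (elemsℕ p)
elemsℕ (outside ∷ p) = map suc (elemsℕ p)

elemsℕ≡map-toℕ : ∀ {n} (p : Subset n) → elemsℕ p ≡ map toℕ (elems p)

map-suc-elemsℕ : ∀ {n} (p : Subset n) → map suc (elemsℕ p) ≡ map toℕ (map Fin.suc (elems p))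
map-suc-elemsℕ p = trans (cong (map suc) (elemsℕ≡map-toℕ p)) (trans (sym (map-∘ (elems p))) (map-∘ (elems p)))

elemsℕ≡map-toℕ []            = refl
elemsℕ≡map-toℕ (inside  ∷ p) = cong (0 ∷_) (map-suc-elemsℕ p)
elemsℕ≡map-toℕ (outside ∷ p) = map-suc-elemsℕ p

infix 4 _≤*_
_≤*_ : List ℕ → List ℕ → Set
_≤*_ = Pointwise _≤_

isSchubertBasis⇔≤* : ∀ {n} (C B : Subset n) → IsSchubertBasis C B ⇔ elemsℕ B ≤* elemsℕ C
isSchubertBasis⇔≤* C B = mk⇔
  (λ B≤C → subst₂ _≤*_ (sym (elemsℕ≡map-toℕ B)) (sym (elemsℕ≡map-toℕ C)) (PW.map⁺ toℕ toℕ B≤C))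
  (λ B≤C → PW.map⁻ toℕ toℕ (subst₂ _≤*_ (elemsℕ≡map-toℕ B) (elemsℕ≡map-toℕ C) B≤C))

-- The d zeros stand for elements of B already passed by the scan and not yet matched
-- with an element of C.
pad : ℕ → List ℕ → List ℕ
pad zero    xs = xs
pad (suc d) xs = 0 ∷ pad d xs

pad-0∷ : ∀ d xs → pad d (0 ∷ xs) ≡ pad (suc d) xs
pad-0∷ zero    xs = refl
pad-0∷ (suc d) xs = cong (0 ∷_) (pad-0∷ d xs)

0∷-≤*⇔ : ∀ {xs y ys} → 0 ∷ xs ≤* y ∷ ys ⇔ xs ≤* ys
0∷-≤*⇔ = mk⇔ (λ { (_ ∷ xs≤ys) → xs≤ys }) (z≤n ∷_)

pad-map-suc-≤*⁻ : ∀ d xs ys → pad d (map suc xs) ≤* map suc ys → pad d xs ≤* ys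
pad-map-suc-≤*⁻ zero    []       []       []                 = []
pad-map-suc-≤*⁻ zero    (x ∷ xs) (y ∷ ys) (s≤s x≤y ∷ xs≤ys) = x≤y ∷ pad-map-suc-≤*⁻ zero xs ys xs≤ys
pad-map-suc-≤*⁻ (suc d) xs       (y ∷ ys) (_ ∷ xs≤ys)        = z≤n ∷ pad-map-suc-≤*⁻ d xs ys xs≤ys

pad-map-suc-≤*⁺ : ∀ d xs ys → pad d xs ≤* ys → pad d (map suc xs) ≤* map suc ys
pad-map-suc-≤*⁺ zero    []       []       []            = []
pad-map-suc-≤*⁺ zero    (x ∷ xs) (y ∷ ys) (x≤y ∷ xs≤ys) = s≤s x≤y ∷ pad-map-suc-≤*⁺ zero xs ys xs≤ys
pad-map-suc-≤*⁺ (suc d) xs       (y ∷ ys) (_ ∷ xs≤ys)   = z≤n ∷ pad-map-suc-≤*⁺ d xs ys xs≤ys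

pad-map-suc-≤*⇔ : ∀ d xs ys → pad d (map suc xs) ≤* map suc ys ⇔ pad d xs ≤* ys
pad-map-suc-≤*⇔ d xs ys = mk⇔ (pad-map-suc-≤*⁻ d xs ys) (pad-map-suc-≤*⁺ d xs ys)

∷-≤*⇔ : ∀ {m} b c {d d′} (B C : Subset m) → boolToℕ c + d′ ≡ boolToℕ b + d →
  pad d (elemsℕ (b ∷ B)) ≤* elemsℕ (c ∷ C) ⇔ pad d′ (elemsℕ B) ≤* elemsℕ C
∷-≤*⇔ true  true  {d}     B C refl rewrite pad-0∷ d (map suc (elemsℕ B)) = pad-map-suc-≤*⇔ d _ _ ⇔-∘ 0∷-≤*⇔
∷-≤*⇔ true  false {d}     B C refl rewrite pad-0∷ d (map suc (elemsℕ B)) = pad-map-suc-≤*⇔ (suc d) _ _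
∷-≤*⇔ false false {d}     B C refl = pad-map-suc-≤*⇔ d _ _
∷-≤*⇔ false true  {suc d} B C refl = pad-map-suc-≤*⇔ d _ _ ⇔-∘ 0∷-≤*⇔

Dominates : ∀ {m} → ℕ → Subset m → Subset m → Set
Dominates {m} d B C =
  (∀ k → count (member C) k ≤ d + count (member B) k) × count (member C) m ≡ d + count (member B) m

∷-dominates⇔ : ∀ {m} b c {d d′} (B C : Subset m) → boolToℕ c + d′ ≡ boolToℕ b + d →
  Dominates d (b ∷ B) (c ∷ C) ⇔ Dominates d′ B C
∷-dominates⇔ {m} b c {d} {d′} B C lag = mk⇔
  (λ (prefix , total) →
     (λ k → +-cancelˡ-≤ (boolToℕ c) _ _ (subst₂ _≤_ (count-member-∷ c C k) (shift k) (prefix (suc k)))) ,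
     +-cancelˡ-≡ (boolToℕ c) _ _ (trans (sym (count-member-∷ c C m)) (trans total (shift m))))
  (λ (prefix , total) → prefix′ prefix ,
     trans (count-member-∷ c C m) (trans (cong (boolToℕ c +_) total) (sym (shift m))))
  where
  shift : ∀ k → d + count (member (b ∷ B)) (suc k) ≡ boolToℕ c + (d′ + count (member B) k)
  shift k = begin
    d + count (member (b ∷ B)) (suc k)       ≡⟨ cong (d +_) (count-member-∷ b B k) ⟩
    d + (boolToℕ b + count (member B) k)     ≡⟨ +-assoc d _ _ ⟨
    (d + boolToℕ b) + count (member B) k     ≡⟨ cong (_+ count (member B) k) (trans (+-comm d _) (sym lag)) ⟩
    (boolToℕ c + d′) + count (member B) k    ≡⟨ +-assoc (boolToℕ c) _ _ ⟩
    boolToℕ c + (d′ + count (member B) k)    ∎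
    where open ≡-Reasoning
  prefix′ : (∀ k → count (member C) k ≤ d′ + count (member B) k) →
            ∀ k → count (member (c ∷ C)) k ≤ d + count (member (b ∷ B)) k
  prefix′ prefix zero    = z≤n
  prefix′ prefix (suc k) =
    subst₂ _≤_ (sym (count-member-∷ c C k)) (sym (shift k)) (+-monoʳ-≤ (boolToℕ c) (prefix k))

pad-≤*⇔dominates-∷ : ∀ {m} b c {d d′} (B C : Subset m) → boolToℕ c + d′ ≡ boolToℕ b + d →
  (pad d′ (elemsℕ B) ≤* elemsℕ C ⇔ Dominates d′ B C) →
  pad d (elemsℕ (b ∷ B)) ≤* elemsℕ (c ∷ C) ⇔ Dominates d (b ∷ B) (c ∷ C)
pad-≤*⇔dominates-∷ b c B C lag tail⇔ = ⇔-sym (∷-dominates⇔ b c B C lag) ⇔-∘ (tail⇔ ⇔-∘ ∷-≤*⇔ b c B C lag)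

pad-≤*⇔dominates : ∀ {m} d (B C : Subset m) → pad d (elemsℕ B) ≤* elemsℕ C ⇔ Dominates d B C
pad-≤*⇔dominates zero    []            []           = mk⇔ (λ _ → (λ _ → ≤-refl) , refl) (λ _ → [])
pad-≤*⇔dominates (suc d) []            []           = mk⇔ (λ ()) (λ { (_ , ()) })
pad-≤*⇔dominates d       (true  ∷ B)   (true  ∷ C)  = pad-≤*⇔dominates-∷ true true B C refl (pad-≤*⇔dominates d B C)
pad-≤*⇔dominates d       (true  ∷ B)   (false ∷ C)  = pad-≤*⇔dominates-∷ true false B C refl (pad-≤*⇔dominates (suc d) B C)
pad-≤*⇔dominates d       (false ∷ B)   (false ∷ C)  = pad-≤*⇔dominates-∷ false false B C refl (pad-≤*⇔dominates d B C)
pad-≤*⇔dominates (suc d) (false ∷ B)   (true  ∷ C)  = pad-≤*⇔dominates-∷ false true B C refl (pad-≤*⇔dominates d B C)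
pad-≤*⇔dominates zero    (false ∷ B)   (true  ∷ C)  =
  mk⇔ (⊥-elim ∘ map-suc-≰0∷ (elemsℕ B)) (λ (prefix , _) → ⊥-elim (<-irrefl refl (prefix 1)))
  where
  map-suc-≰0∷ : ∀ xs {ys} → ¬ (map suc xs ≤* 0 ∷ ys)
  map-suc-≰0∷ (x ∷ xs) (() ∷ _)

isSchubertBasis⇔dominates : ∀ {n} (C B : Subset n) → IsSchubertBasis C B ⇔ Dominates 0 B C
isSchubertBasis⇔dominates C B = pad-≤*⇔dominates 0 B C ⇔-∘ isSchubertBasis⇔≤* C B

maximum-≤ : ∀ {A : Set} (h : A → ℕ) xs {k} → (∀ x → x ∈ₗ xs → h x ≤ k) → maximum (map h xs) ≤ k
maximum-≤ h []       _     = z≤n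
maximum-≤ h (x ∷ xs) bound = ⊔-lub (bound x (here refl)) (maximum-≤ h xs (λ y y∈xs → bound y (there y∈xs)))

≤-maximum : ∀ {A : Set} (h : A → ℕ) {x xs} → x ∈ₗ xs → h x ≤ maximum (map h xs)
≤-maximum h {xs = y ∷ xs} (here refl) = m≤m⊔n (h y) _
≤-maximum h {xs = y ∷ xs} (there x∈xs) = ≤-trans (≤-maximum h x∈xs) (m≤n⊔m (h y) _)

∈-allSubsets : ∀ n (p : Subset n) → p ∈ₗ allSubsets n
∈-allSubsets zero    []            = here refl
∈-allSubsets (suc n) (inside  ∷ p) = ∈-++⁺ˡ (∈-map⁺ (inside ∷_) (∈-allSubsets n p))
∈-allSubsets (suc n) (outside ∷ p) = ∈-++⁺ʳ (map (inside ∷_) (allSubsets n)) (∈-map⁺ (outside ∷_) (∈-allSubsets n p))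

atℕ : ∀ {n} {A : Set} → (Fin n → Maybe A) → ℕ → Maybe A
atℕ {zero}  F _       = nothing
atℕ {suc n} F zero    = F zero
atℕ {suc n} F (suc r) = atℕ (λ i → F (suc i)) r

atℕ-toℕ : ∀ {n} {A : Set} (F : Fin n → Maybe A) i → atℕ F (toℕ i) ≡ F i
atℕ-toℕ F zero    = refl
atℕ-toℕ F (suc i) = atℕ-toℕ (λ i → F (suc i)) i

atℕ-just : ∀ {n} {A : Set} (F : Fin n → Maybe A) r {x} → atℕ F r ≡ just x → ∃[ i ] toℕ i ≡ r × F i ≡ just x
atℕ-just {suc n} F zero    Fr = zero , refl , Fr
atℕ-just {suc n} F (suc r) Fr with atℕ-just (λ i → F (suc i)) r Fr
... | i , i≡r , Fi = suc i , cong suc i≡r , Fi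

∣∷∣ : ∀ {n} b (p : Subset n) → ∣ b ∷ p ∣ ≡ boolToℕ b + ∣ p ∣
∣∷∣ true  p = refl
∣∷∣ false p = refl

∣tabulate-is-just∣ : ∀ {n} {A : Set} (F : Fin n → Maybe A) → ∣ tabulate (λ i → is-just (F i)) ∣ ≡ count (filled (atℕ F)) n
∣tabulate-is-just∣ {zero}  F = refl
∣tabulate-is-just∣ {suc n} F = begin
  ∣ tabulate (λ i → is-just (F i)) ∣                                     ≡⟨ ∣∷∣ (is-just (F zero)) (tabulate (λ i → is-just (F (suc i)))) ⟩
  boolToℕ (is-just (F zero)) + ∣ tabulate (λ i → is-just (F (suc i))) ∣ ≡⟨ cong (boolToℕ (is-just (F zero)) +_) (∣tabulate-is-just∣ (λ i → F (suc i))) ⟩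
  boolToℕ (is-just (F zero)) + count (filled (atℕ (λ i → F (suc i)))) n ≡⟨ count-shift (filled (atℕ F)) n ⟨
  count (filled (atℕ F)) (suc n)                                         ∎
  where open ≡-Reasoning

entryℕ : ∀ {n} → Filling n → ℕ → Maybe ℕ
entryℕ F r = Maybe.map toℕ (atℕ F r)

entryℕ-just : ∀ {n} (F : Filling n) r {j} → entryℕ F r ≡ just j →
  ∃[ i ] ∃[ x ] toℕ i ≡ r × toℕ x ≡ j × F i ≡ just x
entryℕ-just F r e with atℕ F r in Fr
entryℕ-just F r refl | just x with atℕ-just F r Fr
... | i , i≡r , Fi = i , x , i≡r , refl , Fi

filled⇒just : ∀ {A : Set} (f : ℕ → Maybe A) r → filled f r ≡ true → ∃[ x ] f r ≡ just x
filled⇒just f r fr with f r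
... | just x = x , refl

is-just-map : ∀ {A B : Set} (g : A → B) m → is-just (Maybe.map g m) ≡ is-just m
is-just-map g nothing  = refl
is-just-map g (just _) = refl

fillingSize≡count-entryℕ : ∀ {n} (F : Filling n) → fillingSize F ≡ count (filled (entryℕ F)) n
fillingSize≡count-entryℕ {n} F =
  trans (∣tabulate-is-just∣ F) (count-cong n (λ r _ → sym (is-just-map toℕ (atℕ F r))))

entryℕ-rows : ∀ {n} {C : Subset n} {F} → OnlyInColumn C F → filled (entryℕ F) ⊆ᵇ member C
entryℕ-rows {F = F} onlyInC r fr with filled⇒just (entryℕ F) r fr
... | j , e with entryℕ-just F r e
... | i , x , refl , _ , Fi = ∈⇒member (onlyInC i x Fi)

entryℕ-columnStrict : ∀ {n} {F : Filling n} → ColumnStrict F → ColumnStrictℕ (entryℕ F)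
entryℕ-columnStrict {F = F} strict r r′ j e e′ with entryℕ-just F r e | entryℕ-just F r′ e′
... | i , x , refl , x≡j , Fi | i′ , x′ , refl , x′≡j , Fi′ with toℕ-injective (trans x≡j (sym x′≡j))
... | refl = cong toℕ (strict i i′ x Fi Fi′)

entryℕ-flagged : ∀ {n} {F : Filling n} → Flagged F → Flaggedℕ (entryℕ F)
entryℕ-flagged {F = F} flagged r j e with entryℕ-just F r e
... | i , x , refl , refl , Fi = flagged i x Fi

entryℕ-entries : ∀ {n} {S : Subset n} {F} → EntriesIn S F → ∀ r j → entryℕ F r ≡ just j → member S j ≡ true
entryℕ-entries {F = F} entriesInS r j e with entryℕ-just F r e
... | i , x , _ , refl , Fi = ∈⇒member (entriesInS i x Fi)

toFin : ∀ {n} → Maybe ℕ → Maybe (Fin n)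
toFin         nothing  = nothing
toFin {n} (just j) with j <? n
... | yes j<n = just (fromℕ< j<n)
... | no  _   = nothing

toFin-just : ∀ {n} m {x : Fin n} → toFin m ≡ just x → m ≡ just (toℕ x)
toFin-just {n} (just j) e with j <? n
toFin-just     (just j) refl | yes j<n = cong just (sym (toℕ-fromℕ< j<n))

map-toℕ-toFin : ∀ {n} m → (∀ j → m ≡ just j → j < n) → Maybe.map toℕ (toFin {n} m) ≡ m
map-toℕ-toFin         nothing  _       = refl
map-toℕ-toFin {n} (just j) in-range with j <? n
... | yes j<n = cong just (toℕ-fromℕ< j<n)
... | no  j≮n = ⊥-elim (j≮n (in-range j refl))

fromEntries : ∀ n → (ℕ → Maybe ℕ) → Filling n
fromEntries n f i = toFin (f (toℕ i))

entryℕ-fromEntries : ∀ {n} f → (∀ r j → f r ≡ just j → j < n) → ∀ r → r < n → entryℕ (fromEntries n f) r ≡ f r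
entryℕ-fromEntries {n} f in-range r r<n = begin
  Maybe.map toℕ (atℕ (fromEntries n f) r)       ≡⟨ cong (λ r′ → Maybe.map toℕ (atℕ (fromEntries n f) r′)) (toℕ-fromℕ< r<n) ⟨
  Maybe.map toℕ (atℕ (fromEntries n f) (toℕ i)) ≡⟨ cong (Maybe.map toℕ) (atℕ-toℕ (fromEntries n f) i) ⟩
  Maybe.map toℕ (toFin (f (toℕ i)))             ≡⟨ map-toℕ-toFin (f (toℕ i)) (in-range (toℕ i)) ⟩
  f (toℕ i)                                     ≡⟨ cong f (toℕ-fromℕ< r<n) ⟩
  f r                                           ∎
  where
  open ≡-Reasoning
  i : Fin n
  i = fromℕ< r<n

module _ (n : ℕ) (C S : Subset n) where
  open Greedy (member C) (member S)
  open GreedyFilling (greedyFilling n)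
  open GreedyBasis n (member-beyond C)

  ∣S∩B∣≡count : ∀ B → ∣ S ∩ B ∣ ≡ count (λ x → member S x ∧ member B x) n
  ∣S∩B∣≡count B = trans (∣∣≡count-member (S ∩ B)) (count-cong n (λ r _ → member-∩ S B r))

  rank≤greedy : schubertRank C S ≤ greedy n
  rank≤greedy = maximum-≤ (λ B → ∣ S ∩ B ∣) (schubertBases C) bound
    where
    bound : ∀ B → B ∈ₗ schubertBases C → ∣ S ∩ B ∣ ≤ greedy n
    bound B B∈bases with Equivalence.to (isSchubertBasis⇔dominates C B) (proj₂ (∈-filter⁻ (isSchubertBasis? C) {xs = allSubsets n} B∈bases))
    ... | dominates , total =
      subst (_≤ greedy n) (sym (∣S∩B∣≡count B)) (hall-bound⇒≤greedy {n = n} (basis-hall-bound dominates total))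

  fillingSize≤greedy : ∀ F → InFillings C S F → fillingSize F ≤ greedy n
  fillingSize≤greedy F (inC , strict , flag , inS) =
    subst (_≤ greedy n) (sym (fillingSize≡count-entryℕ F)) (hall-bound⇒≤greedy {n = n}
      (filling-hall-bound (entryℕ-rows inC) (entryℕ-columnStrict strict) (entryℕ-flagged flag) (entryℕ-entries inS)))

  greedyBasis : Subset n
  greedyBasis = subsetOf n basis

  member-greedyBasis : ∀ r → member greedyBasis r ≡ basis r
  member-greedyBasis = member-subsetOf n basis basis-beyond

  greedyBasis-isBasis : IsSchubertBasis C greedyBasis
  greedyBasis-isBasis = Equivalence.from (isSchubertBasis⇔dominates C greedyBasis)
    ( (λ k → subst (count (member C) k ≤_) (count-on-basis k) (basis-dominates k))
    , trans basis-total (count-on-basis n) )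
    where
    count-on-basis : ∀ k → count basis k ≡ count (member greedyBasis) k
    count-on-basis k = count-cong k (λ r _ → sym (member-greedyBasis r))

  greedy≤rank : greedy n ≤ schubertRank C S
  greedy≤rank = begin
    greedy n                                          ≤⟨ greedy≤count-S∩basis ⟩
    count (λ x → member S x ∧ basis x) n              ≡⟨ count-cong n (λ r _ → cong (member S r ∧_) (member-greedyBasis r)) ⟨
    count (λ x → member S x ∧ member greedyBasis x) n ≡⟨ ∣S∩B∣≡count greedyBasis ⟨
    ∣ S ∩ greedyBasis ∣                               ≤⟨ ≤-maximum (λ B → ∣ S ∩ B ∣) greedyBasis∈bases ⟩
    schubertRank C S                                  ∎
    where
    open ≤-Reasoning
    greedyBasis∈bases : greedyBasis ∈ₗ schubertBases C
    greedyBasis∈bases = ∈-filter⁺ (isSchubertBasis? C) (∈-allSubsets n greedyBasis) greedyBasis-isBasis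

  entry-below-n : ∀ r j → entry r ≡ just j → j < n
  entry-below-n r j e = ≤-<-trans (flagged r j e) (filled-below (greedyFilling n) r (cong is-just e))

  greedyColumnFilling : Filling n
  greedyColumnFilling = fromEntries n entry

  greedyColumnFilling∈ : InFillings C S greedyColumnFilling
  greedyColumnFilling∈ =
    (λ i x e → member⇒∈ i C (filled⇒C (greedyFilling n) (toℕ i) (cong is-just (toFin-just _ e)))) ,
    (λ i i′ x e e′ → toℕ-injective (injective _ _ _ (toFin-just _ e) (toFin-just _ e′))) ,
    (λ i x e → flagged _ _ (toFin-just _ e)) ,
    (λ i x e → member⇒∈ x S (used⇒S _ (entry-used _ _ (toFin-just _ e))))

  fillingSize-greedyColumnFilling : fillingSize greedyColumnFilling ≡ greedy n
  fillingSize-greedyColumnFilling = begin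
    fillingSize greedyColumnFilling                      ≡⟨ fillingSize≡count-entryℕ greedyColumnFilling ⟩
    count (filled (entryℕ greedyColumnFilling)) n        ≡⟨ count-cong n (λ r r<n → cong is-just (entryℕ-fromEntries entry entry-below-n r r<n)) ⟩
    count (filled entry) n                               ≡⟨ count-filled (greedyFilling n) ⟩
    greedy n                                             ∎
    where open ≡-Reasoning

theorem3p4 : (n : ℕ) (C S : Subset n) →
    (Σ (Filling n) λ F → InFillings C S F × fillingSize F ≡ schubertRank C S)
    × ((F : Filling n) → InFillings C S F → fillingSize F ≤ schubertRank C S)
theorem3p4 n C S =
  (greedyColumnFilling n C S , greedyColumnFilling∈ n C S , trans (fillingSize-greedyColumnFilling n C S) (sym rank≡greedy)) ,
  λ F F∈ → subst (fillingSize F ≤_) (sym rank≡greedy) (fillingSize≤greedy n C S F F∈)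
  where
  rank≡greedy : schubertRank C S ≡ Greedy.greedy (member C) (member S) n
  rank≡greedy = ≤-antisym (rank≤greedy n C S) (greedy≤rank n C S)
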